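{- For every $n\ge 4$, in the edge-distinguishing game (EDGe) played on the wheel graph $W_n$ (with $\lambda(W_n)$ colors), Player 1 has a winning strategy if $n$ is odd, and Player 2 has a winning strategy if $n$ is even.
   Context: The wheel $W_n$ is the join $C_{n-1}\nabla K_1$ of a cycle on $n-1$ vertices with a hub vertex adjacent to all cycle vertices. For a positive integer $k$ let $[k]=\{1,\dots,k\}$. A $k$-coloring $c:V(G)\to[k]$ induces $c'(\{u,v\})=\{c(u),c(v)\}$ (a multiset); $c$ is edge-distinguishing if $c'$ is injective, and $\lambda(G)$ is the least $k$ admitting such a coloring. A partial coloring $c:U\to[k]$, $U\subseteq V(G)$, has partial induced edge coloring equal to the induced edge coloring on $G[U]$. EDGe on $G$: two players, Player 1 first, alternately color an uncolored vertex with a color from $[\lambda(G)]$; a move is legal iff afterwards the partial induced edge coloring of the colored vertices is injective. The player making the last legal move wins. A winning strategy guarantees a win regardless of the opponent's play. -}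

module Defs where

open import Data.Nat using (ℕ; zero; suc; _<_)
open import Data.Fin using (Fin; toℕ; _≟_)
open import Data.Maybe using (Maybe; just; nothing)
open import Data.Product using (Σ; _×_; _,_)
open import Data.Sum using (_⊎_)
open import Relation.Nullary using (¬_; yes; no)
open import Relation.Binary.PropositionalEquality using (_≡_)

Graph : ℕ → Set₁
Graph n = Fin n → Fin n → Set

CycleNext : ℕ → ℕ → ℕ → Set
CycleNext m a b = (suc a ≡ b) ⊎ ((a ≡ m) × (b ≡ 1))

-- The wheel W_n on vertex set Fin n: vertex 0 is the hub, vertices
-- 1 … n-1 form the cycle C_{n-1} (i adjacent to i+1, and n-1 adjacent to 1).
WheelAdj : (n : ℕ) → Graph n
WheelAdj zero () _
WheelAdj (suc m) u v =
    ((toℕ u ≡ 0) × ¬ (toℕ v ≡ 0))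
  ⊎ (¬ (toℕ u ≡ 0) × (toℕ v ≡ 0))
  ⊎ (¬ (toℕ u ≡ 0) × ¬ (toℕ v ≡ 0)
       × (CycleNext m (toℕ u) (toℕ v) ⊎ CycleNext m (toℕ v) (toℕ u)))

SameMultiset : {A : Set} → A → A → A → A → Set
SameMultiset a b c d = ((a ≡ c) × (b ≡ d)) ⊎ ((a ≡ d) × (b ≡ c))

-- c is edge-distinguishing: the induced edge coloring {u,v} ↦ {c u, c v}
-- is injective on edges (edges are unordered pairs of adjacent vertices).
EdgeDistinguishing : {n k : ℕ} → Graph n → (Fin n → Fin k) → Set
EdgeDistinguishing {n} G c =
  ∀ (u v x y : Fin n) → G u v → G x y →
  SameMultiset (c u) (c v) (c x) (c y) → SameMultiset u v x y

IsLambda : {n : ℕ} → Graph n → ℕ → Set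
IsLambda {n} G k =
    Σ (Fin n → Fin k) (λ c → EdgeDistinguishing G c)
  × (∀ (j : ℕ) → j < k → ¬ Σ (Fin n → Fin j) (λ c → EdgeDistinguishing G c))

-- Partial colorings: nothing = uncolored.
Position : ℕ → ℕ → Set
Position n k = Fin n → Maybe (Fin k)

Legal : {n k : ℕ} → Graph n → Position n k → Set
Legal {n} G p =
  ∀ (u v x y : Fin n) → G u v → G x y →
  ∀ a b a' b' → p u ≡ just a → p v ≡ just b → p x ≡ just a' → p y ≡ just b' →
  SameMultiset a b a' b' → SameMultiset u v x y

set : {n k : ℕ} → Position n k → Fin n → Fin k → Position n k
set p v c w with w ≟ v
... | yes _ = just c
... | no  _ = p w

-- Game values, for the player about to move (normal play: last legal move wins).
-- ToMoveLoses p : the other player has a winning strategy.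
-- (The game is finite, so these inductive predicates capture winning strategies.)
data ToMoveWins {n k : ℕ} (G : Graph n) (p : Position n k) : Set
data ToMoveLoses {n k : ℕ} (G : Graph n) (p : Position n k) : Set

data ToMoveWins {n} {k} G p where
  move : (v : Fin n) (c : Fin k) → p v ≡ nothing → Legal G (set p v c) →
         ToMoveLoses G (set p v c) → ToMoveWins G p

data ToMoveLoses {n} {k} G p where
  allMoves : ((v : Fin n) (c : Fin k) → p v ≡ nothing → Legal G (set p v c) →
              ToMoveWins G (set p v c)) → ToMoveLoses G p

empty : {n k : ℕ} → Position n k
empty _ = nothing

Player1Wins : {n : ℕ} → Graph n → ℕ → Set
Player1Wins G k = ToMoveWins {k = k} G empty

Player2Wins : {n : ℕ} → Graph n → ℕ → Set
Player2Wins G k = ToMoveLoses {k = k} G empty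

{-# OPTIONS --safe #-}
-- An edge-distinguishing colouring of W_n is injective: two rim vertices of one
-- colour give two spokes of one colour, and a rim vertex of the hub's colour gives a
-- spoke and a rim edge of one colour. So λ(W_n) ≥ n and an unused colour always exists.
-- Once the hub has a colour h, a move exists whenever an odd number of vertices is
-- uncoloured: colour, with an unused colour, an uncoloured rim vertex none of whose
-- rim neighbours has colour h. If some rim vertex has colour h, its two neighbours
-- must be uncoloured, and by oddness a third uncoloured vertex remains. Hence from
-- then on every play fills the graph and parity decides: the first player takes
-- the hub when n is odd, and when n is even the second player takes it at once
-- unless the first player already did.
module Submission where

open import Defs
open import Data.Nat using (ℕ; _≤_; _%_)
open import Data.Product using (_×_)
open import Relation.Binary.PropositionalEquality using (_≡_)

open import Data.Nat using (zero; suc; _+_; _<_; z≤n; s≤s)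
open import Data.Nat.Properties
  using (+-suc; ≤-refl; ≤-trans; n≤1+n; ≤∧≢⇒<; <⇒≢; <⇒≱; <-irrefl)
  renaming (_≟_ to _≟ℕ_; suc-injective to ℕ-suc-injective)
open import Data.Fin using (Fin; zero; suc; toℕ; fromℕ<; punchOut; _≟_)
open import Data.Fin.Properties
  using (suc-injective; toℕ-injective; toℕ-fromℕ<; fromℕ<-injective; toℕ<n;
         any?; all?; ¬∀⟶∃¬; injective⇒≤; punchOut-injective)
open import Data.Maybe using (just; nothing; maybe′)
open import Data.Maybe.Properties using (just-injective) renaming (≡-dec to ≡-dec-Maybe)
open import Data.Product using (∃; ∃₂; _,_; proj₁; proj₂)
open import Data.Sum using (_⊎_; inj₁; inj₂; [_,_]′) renaming (swap to ⊎-swap)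
open import Function using (_∘_)
open import Function.Definitions using (Injective)
open import Relation.Binary.Definitions using (Symmetric)
open import Relation.Binary.PropositionalEquality
  using (_≢_; refl; sym; trans; cong; subst; module ≡-Reasoning)
open import Relation.Nullary using (Dec; yes; no; contradiction)

private
  variable
    n k N : ℕ

set-updates : (p : Position n k) (v : Fin n) (c : Fin k) → set p v c v ≡ just c
set-updates p v c with v ≟ v
... | yes _    = refl
... | no  v≢v  = contradiction refl v≢v

set-minimal : (p : Position n k) {v w : Fin n} (c : Fin k) → w ≢ v → set p v c w ≡ p w
set-minimal p {v} {w} c w≢v with w ≟ v
... | yes w≡v = contradiction w≡v w≢v
... | no  _   = refl

set-coloured : (p : Position n k) {v w : Fin n} {c a : Fin k} →
               set p v c w ≡ just a → (w ≡ v × c ≡ a) ⊎ p w ≡ just a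
set-coloured p {v} {w} q≡a with w ≟ v
... | yes w≡v = inj₁ (w≡v , just-injective q≡a)
... | no  _   = inj₂ q≡a

set-suc : (p : Position (suc n) k) (v : Fin n) (c : Fin k) (w : Fin n) →
          set p (suc v) c (suc w) ≡ set (p ∘ suc) v c w
set-suc p v c w with w ≟ v
... | yes _ = refl
... | no  _ = refl

coloured≢uncoloured : {p : Position n k} {u v : Fin n} {a : Fin k} →
                      p u ≡ just a → p v ≡ nothing → u ≢ v
coloured≢uncoloured pu pv refl with trans (sym pu) pv
... | ()

uncoloured : Position n k → ℕ
uncoloured {zero}  p = 0
uncoloured {suc n} p = maybe′ (λ _ → 0) 1 (p zero) + uncoloured (p ∘ suc)

uncoloured-cong : {p q : Position n k} → (∀ w → p w ≡ q w) → uncoloured p ≡ uncoloured q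
uncoloured-cong {zero}          p≗q = refl
uncoloured-cong {suc n} {q = q} p≗q rewrite p≗q zero =
  cong (maybe′ (λ _ → 0) 1 (q zero) +_) (uncoloured-cong (p≗q ∘ suc))

uncoloured-empty : uncoloured {n} {k} empty ≡ n
uncoloured-empty {zero}      = refl
uncoloured-empty {suc n} {k} = cong suc (uncoloured-empty {n} {k})

uncoloured-set : (p : Position n k) (v : Fin n) (c : Fin k) → p v ≡ nothing →
                 suc (uncoloured (set p v c)) ≡ uncoloured p
uncoloured-set {suc n} p zero    c pv rewrite pv = refl
uncoloured-set {suc n} p (suc v) c pv = begin
  suc (a + uncoloured (set p (suc v) c ∘ suc))  ≡⟨ +-suc a _ ⟨
  a + suc (uncoloured (set p (suc v) c ∘ suc))  ≡⟨ cong (λ u → a + suc u) (uncoloured-cong (set-suc p v c)) ⟩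
  a + suc (uncoloured (set (p ∘ suc) v c))      ≡⟨ cong (a +_) (uncoloured-set (p ∘ suc) v c pv) ⟩
  a + uncoloured (p ∘ suc)                      ∎
  where
  open ≡-Reasoning
  a : ℕ
  a = maybe′ (λ _ → 0) 1 (p zero)

uncoloured-first-move : (v : Fin (suc n)) (c : Fin k) → uncoloured (set empty v c) ≡ n
uncoloured-first-move v c = ℕ-suc-injective (trans (uncoloured-set empty v c refl) uncoloured-empty)

uncoloured-vertex : (p : Position n k) → uncoloured p ≡ suc N → ∃ λ u → p u ≡ nothing
uncoloured-vertex {suc n} p #p with p zero in p0
... | nothing = zero , p0
... | just _  = let u , pu = uncoloured-vertex (p ∘ suc) #p in suc u , pu

-- The colour c only serves to fill a and b.
third-uncoloured : (N : ℕ) {p : Position n k} {a b : Fin n} (c : Fin k) → a ≢ b →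
                   p a ≡ nothing → p b ≡ nothing → uncoloured p ≡ suc (N + N) →
                   ∃ λ u → p u ≡ nothing × u ≢ a × u ≢ b
third-uncoloured N {p} {a} {b} c a≢b pa pb #p =
  avoiding (uncoloured-vertex p₂ (proj₂ (positive {M = N} #p₂)))
  where
  p₁ p₂ : Position _ _
  p₁ = set p a c
  p₂ = set p₁ b c
  p₁b : p₁ b ≡ nothing
  p₁b = trans (set-minimal p c (a≢b ∘ sym)) pb
  #p₂ : suc (suc (uncoloured p₂)) ≡ suc (N + N)
  #p₂ = trans (cong suc (uncoloured-set p₁ b c p₁b)) (trans (uncoloured-set p a c pa) #p)
  positive : ∀ {x M : ℕ} → suc (suc x) ≡ suc (M + M) → ∃ λ x′ → x ≡ suc x′
  positive {M = zero}  ()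
  positive {M = suc M} e = M + M , trans (ℕ-suc-injective (ℕ-suc-injective e)) (+-suc M M)
  avoiding : (∃ λ u → p₂ u ≡ nothing) → ∃ λ u → p u ≡ nothing × u ≢ a × u ≢ b
  avoiding (u , p₂u) = u , pu , u≢a , u≢b
    where
    u≢b : u ≢ b
    u≢b = coloured≢uncoloured {p = p₂} (set-updates p₁ b c) p₂u ∘ sym
    u≢a : u ≢ a
    u≢a = coloured≢uncoloured {p = p₂} (trans (set-minimal p₁ c a≢b) (set-updates p a c)) p₂u ∘ sym
    pu : p u ≡ nothing
    pu = trans (sym (set-minimal p c u≢a)) (trans (sym (set-minimal p₁ c u≢b)) p₂u)

Unused : Position n k → Fin k → Set
Unused p c = ∀ w → p w ≢ just c

used? : (p : Position n k) (c : Fin k) → Dec (∃ λ w → p w ≡ just c)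
used? p c = any? (λ w → ≡-dec-Maybe _≟_ (p w) (just c))

-- If every colour were used, choosing a vertex of each colour and punching out the
-- uncoloured vertex u would inject Fin k into Fin (n - 1).
unused-colour : n ≤ k → (p : Position n k) {u : Fin n} → p u ≡ nothing → ∃ (Unused p)
unused-colour {suc m} {k} n≤k p {u} pu with all? (used? p)
... | no ¬allUsed =
  let c , unused = ¬∀⟶∃¬ k _ (used? p) ¬allUsed in c , λ w pw → unused (w , pw)
... | yes allUsed = contradiction (injective⇒≤ punchOut∘owner-injective) (<⇒≱ n≤k)
  where
  owner : Fin k → Fin (suc m)
  owner c = proj₁ (allUsed c)
  u≢owner : ∀ c → u ≢ owner c
  u≢owner c = coloured≢uncoloured {p = p} (proj₂ (allUsed c)) pu ∘ sym
  punchOut∘owner-injective : Injective _≡_ _≡_ (λ c → punchOut (u≢owner c))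
  punchOut∘owner-injective {c} {c′} eq = just-injective (begin
    just c             ≡⟨ proj₂ (allUsed c) ⟨
    p (owner c)        ≡⟨ cong p (punchOut-injective (u≢owner c) (u≢owner c′) eq) ⟩
    p (owner c′)       ≡⟨ proj₂ (allUsed c′) ⟩
    just c′            ∎)
    where open ≡-Reasoning

SameMultiset-swapʳ : {A : Set} {a b c d : A} → SameMultiset a b d c → SameMultiset a b c d
SameMultiset-swapʳ = ⊎-swap

OrderedLegal : Graph n → Position n k → Set
OrderedLegal G p = ∀ {u₁ u₂ x₁ x₂ a b} → G u₁ u₂ → G x₁ x₂ →
  p u₁ ≡ just a → p x₁ ≡ just a → p u₂ ≡ just b → p x₂ ≡ just b → SameMultiset u₁ u₂ x₁ x₂

legal⇒ordered : {G : Graph n} {p : Position n k} → Legal G p → OrderedLegal G p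
legal⇒ordered L g h pu₁ px₁ pu₂ px₂ = L _ _ _ _ g h _ _ _ _ pu₁ pu₂ px₁ px₂ (inj₁ (refl , refl))

ordered⇒legal : {G : Graph n} {p : Position n k} → Symmetric G → OrderedLegal G p → Legal G p
ordered⇒legal G-sym L _ _ _ _ g h _ _ _ _ pu₁ pu₂ px₁ px₂ (inj₁ (refl , refl)) =
  L g h pu₁ px₁ pu₂ px₂
ordered⇒legal G-sym L _ _ _ _ g h _ _ _ _ pu₁ pu₂ px₁ px₂ (inj₂ (refl , refl)) =
  SameMultiset-swapʳ (L g (G-sym h) pu₁ px₂ pu₂ px₁)

edgeDistinguishing⇒legal : {G : Graph n} {c : Fin n → Fin k} →
                           EdgeDistinguishing G c → Legal G (just ∘ c)
edgeDistinguishing⇒legal ed u v x y g h _ _ _ _ refl refl refl refl = ed u v x y g h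

empty-legal : {G : Graph n} → Legal G (empty {k = k})
empty-legal _ _ _ _ _ _ _ _ _ _ ()

RainbowNeighbourhood : Graph n → Position n k → Fin n → Set
RainbowNeighbourhood G p v =
  ∀ {w w′ a} → G v w → G v w′ → p w ≡ just a → p w′ ≡ just a → w ≡ w′

-- An unused colour at v can only be matched by an edge through v, and there
-- the other endpoints are told apart by their colours.
legal-set-unused : {G : Graph n} {p : Position n k} {v : Fin n} {c : Fin k} →
                   Symmetric G → Legal G p → Unused p c → RainbowNeighbourhood G p v →
                   Legal G (set p v c)
legal-set-unused {G = G} {p} {v} {c} G-sym L unused rainbow = ordered⇒legal G-sym ordered
  where
  same-colour : ∀ {w w′ a} → set p v c w ≡ just a → set p v c w′ ≡ just a →
                (w ≡ v × w′ ≡ v) ⊎ (p w ≡ just a × p w′ ≡ just a)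
  same-colour qw qw′ with set-coloured p qw | set-coloured p qw′
  ... | inj₁ (w≡v , _)  | inj₁ (w′≡v , _) = inj₁ (w≡v , w′≡v)
  ... | inj₁ (_ , refl) | inj₂ pw′        = contradiction pw′ (unused _)
  ... | inj₂ pw         | inj₁ (_ , refl) = contradiction pw (unused _)
  ... | inj₂ pw         | inj₂ pw′        = inj₂ (pw , pw′)

  ordered : OrderedLegal G (set p v c)
  ordered {u₁} {u₂} {x₁} {x₂} g h qu₁ qx₁ qu₂ qx₂
    with same-colour {u₁} {x₁} qu₁ qx₁ | same-colour {u₂} {x₂} qu₂ qx₂
  ... | inj₁ (refl , refl) | inj₁ (refl , refl) = inj₁ (refl , refl)
  ... | inj₁ (refl , refl) | inj₂ (pu₂ , px₂)   = inj₁ (refl , rainbow g h pu₂ px₂)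
  ... | inj₂ (pu₁ , px₁)   | inj₁ (refl , refl) = inj₁ (rainbow (G-sym g) (G-sym h) pu₁ px₁ , refl)
  ... | inj₂ (pu₁ , px₁)   | inj₂ (pu₂ , px₂)   = legal⇒ordered L g h pu₁ px₁ pu₂ px₂

LegalMove : Graph n → Position n k → Set
LegalMove G p = ∃₂ λ v c → p v ≡ nothing × Legal G (set p v c)

module ParityPlay {G : Graph n} (Inv : Position n k → Set)
  (Inv-set : ∀ {p v c} → Inv p → p v ≡ nothing → Inv (set p v c))
  (move-at-odd : ∀ N {p} → Legal G p → Inv p → uncoloured p ≡ suc (N + N) → LegalMove G p)
  where

  even⇒loses : ∀ N {p} → Legal G p → Inv p → uncoloured p ≡ N + N → ToMoveLoses G p
  odd⇒wins   : ∀ N {p} → Legal G p → Inv p → uncoloured p ≡ suc (N + N) → ToMoveWins G p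

  even⇒loses zero    {p} _ _ #p = allMoves λ v c pv _ →
    contradiction (trans (uncoloured-set p v c pv) #p) λ ()
  even⇒loses (suc N) {p} _ I #p = allMoves λ v c pv L′ →
    odd⇒wins N L′ (Inv-set I pv)
      (trans (ℕ-suc-injective (trans (uncoloured-set p v c pv) #p)) (+-suc N N))

  odd⇒wins N {p} L I #p with move-at-odd N L I #p
  ... | v , c , pv , L′ = move v c pv L′
    (even⇒loses N L′ (Inv-set I pv) (ℕ-suc-injective (trans (uncoloured-set p v c pv) #p)))

record RimNeighbours {m : ℕ} (G : Graph (suc m)) (j : Fin m) : Set where
  field
    left right : Fin m
    left≢right : left ≢ right
    adj-left   : G (suc j) (suc left)
    adj-right  : G (suc j) (suc right)
    only       : ∀ {x} → G (suc j) (suc x) → x ≡ left ⊎ x ≡ right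

-- G is the cone, with apex zero, over a 2-regular graph on the rim vertices suc j.
module Cone {m : ℕ} {G : Graph (suc m)} (G-sym : Symmetric G)
            (spoke : ∀ j → G zero (suc j)) (rim : ∀ j → RimNeighbours G j) where

  HubColoured : Position (suc m) k → Set
  HubColoured p = ∃ λ h → p zero ≡ just h

  NoNeighbourColoured : Position (suc m) k → Fin k → Fin m → Set
  NoNeighbourColoured p h j = ∀ {x} → G (suc j) (suc x) → p (suc x) ≢ just h

  spoke-colours-distinct : {p : Position (suc m) k} {h a : Fin k} {i j : Fin m} → Legal G p →
                           p zero ≡ just h → p (suc i) ≡ just a → p (suc j) ≡ just a → i ≡ j
  spoke-colours-distinct L ph pi pj with legal⇒ordered L (spoke _) (spoke _) ph ph pi pj
  ... | inj₁ (_ , si≡sj) = suc-injective si≡sj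

  hubColoured⇒neighbour-uncoloured : {p : Position (suc m) k} {h : Fin k} {i j : Fin m} →
    Legal G p → p zero ≡ just h → p (suc i) ≡ just h → G (suc i) (suc j) → p (suc j) ≡ nothing
  hubColoured⇒neighbour-uncoloured {p = p} {j = j} L ph pi adj with p (suc j) in pj
  ... | nothing = refl
  ... | just _ with legal⇒ordered L adj (spoke j) pi ph pj pj
  ...   | inj₁ (() , _)
  ...   | inj₂ (_ , ())

  free-vertex-beside : (N : ℕ) {p : Position (suc m) k} {h : Fin k} {i : Fin m} → Legal G p →
    p zero ≡ just h → p (suc i) ≡ just h → uncoloured p ≡ suc (N + N) →
    ∃ λ j → p (suc j) ≡ nothing × NoNeighbourColoured p h j
  free-vertex-beside N {p} {h} {i} L ph pi #p =
    beside (third-uncoloured N {p} h (left≢right ∘ suc-injective)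
                             (hubColoured⇒neighbour-uncoloured L ph pi adj-left)
                             (hubColoured⇒neighbour-uncoloured L ph pi adj-right) #p)
    where
    open RimNeighbours (rim i)
    beside : (∃ λ u → p u ≡ nothing × u ≢ suc left × u ≢ suc right) →
             ∃ λ j → p (suc j) ≡ nothing × NoNeighbourColoured p h j
    beside (zero  , p0 , _) = contradiction (trans (sym ph) p0) λ ()
    beside (suc j , pj , j≢l , j≢r) = j , pj , λ adj px →
      [ j≢l ∘ cong suc , j≢r ∘ cong suc ]′
        (only (G-sym (subst (λ x → G (suc j) (suc x)) (spoke-colours-distinct L ph px pi) adj)))

  free-vertex : (N : ℕ) {p : Position (suc m) k} {h : Fin k} → Legal G p → p zero ≡ just h →
                uncoloured p ≡ suc (N + N) → ∃ λ j → p (suc j) ≡ nothing × NoNeighbourColoured p h j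
  free-vertex N {p} {h} L ph #p with used? (p ∘ suc) h
  ... | yes (i , pi) = free-vertex-beside N L ph pi #p
  ... | no  rim-avoids-h with uncoloured-vertex p #p
  ...   | zero  , p0 = contradiction (trans (sym ph) p0) λ ()
  ...   | suc j , pj = j , pj , λ _ px → rim-avoids-h (_ , px)

  -- The hub and the two rim neighbours of a free vertex carry distinct colours,
  -- so any unused colour may be played there.
  move-at-odd : suc m ≤ k → (N : ℕ) {p : Position (suc m) k} → Legal G p → HubColoured p →
                uncoloured p ≡ suc (N + N) → LegalMove G p
  move-at-odd m<k N {p} L (h , ph) #p with free-vertex N L ph #p
  ... | j , pj , free with unused-colour m<k p pj
  ...   | c , unused = suc j , c , pj , legal-set-unused G-sym L unused rainbow
    where
    rainbow : RainbowNeighbourhood G p (suc j)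
    rainbow {zero}  {zero}  _ _   _  _  = refl
    rainbow {zero}  {suc x} _ adj p0 px = contradiction (trans px (trans (sym p0) ph)) (free adj)
    rainbow {suc x} {zero}  adj _ px p0 = contradiction (trans px (trans (sym p0) ph)) (free adj)
    rainbow {suc x} {suc y} _ _   px py = cong suc (spoke-colours-distinct L ph px py)

  HubColoured-set : {p : Position (suc m) k} {v : Fin (suc m)} {c : Fin k} →
                    HubColoured p → p v ≡ nothing → HubColoured (set p v c)
  HubColoured-set {p = p} (h , ph) pv =
    h , trans (set-minimal p _ (coloured≢uncoloured {p = p} ph pv)) ph

  edgeDistinguishing⇒injective : {c : Fin (suc m) → Fin k} →
                                 EdgeDistinguishing G c → Injective _≡_ _≡_ c
  edgeDistinguishing⇒injective {c = c} ed = injective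
    where
    L : Legal G (just ∘ c)
    L = edgeDistinguishing⇒legal ed
    hub≢rim : ∀ j → c zero ≢ c (suc j)
    hub≢rim j c0≡cj with hubColoured⇒neighbour-uncoloured L refl (cong just (sym c0≡cj))
                           (RimNeighbours.adj-left (rim j))
    ... | ()
    injective : Injective _≡_ _≡_ c
    injective {zero}  {zero}  _ = refl
    injective {zero}  {suc j} e = contradiction e (hub≢rim j)
    injective {suc i} {zero}  e = contradiction (sym e) (hub≢rim i)
    injective {suc i} {suc j} e = cong suc (spoke-colours-distinct L refl refl (cong just (sym e)))

  module _ (m<k : suc m ≤ k) where
    open ParityPlay {G = G} HubColoured (λ {p} {v} {c} → HubColoured-set {p = p} {v} {c})
                    (move-at-odd m<k)

    hub-first-wins : (N : ℕ) → m ≡ N + N → ToMoveWins G empty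
    hub-first-wins N m≡N+N with unused-colour m<k empty {zero} refl
    ... | c , unused = move zero c refl L₁
      (even⇒loses N L₁ (c , refl) (trans (uncoloured-first-move zero c) m≡N+N))
      where
      L₁ : Legal G (set empty zero c)
      L₁ = legal-set-unused G-sym empty-legal unused λ _ _ ()

    hub-second-wins : (N : ℕ) → m ≡ suc (N + N) → ToMoveLoses G empty
    hub-second-wins N m≡ = allMoves reply
      where
      reply : (v : Fin (suc m)) (c : Fin k) → empty v ≡ nothing → Legal G (set empty v c) →
              ToMoveWins G (set empty v c)
      reply zero    c _ L₁ = odd⇒wins N L₁ (c , refl) (trans (uncoloured-first-move zero c) m≡)
      reply (suc j) c _ L₁ with unused-colour m<k (set empty (suc j) c) {zero} refl
      ... | h , unused = move zero h refl L₂ (even⇒loses N L₂ (h , refl) #p₂)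
        where
        p₁ : Position (suc m) k
        p₁ = set empty (suc j) c
        only-coloured : ∀ {w a} → p₁ w ≡ just a → w ≡ suc j
        only-coloured pw with set-coloured empty pw
        ... | inj₁ (w≡sj , _) = w≡sj
        L₂ : Legal G (set p₁ zero h)
        L₂ = legal-set-unused G-sym L₁ unused λ _ _ pw pw′ →
               trans (only-coloured pw) (sym (only-coloured pw′))
        #p₂ : uncoloured (set p₁ zero h) ≡ N + N
        #p₂ = ℕ-suc-injective (begin
          suc (uncoloured (set p₁ zero h)) ≡⟨ uncoloured-set p₁ zero h refl ⟩
          uncoloured p₁                    ≡⟨ uncoloured-first-move (suc j) c ⟩
          m                                ≡⟨ m≡ ⟩
          suc (N + N)                      ∎)
          where open ≡-Reasoning

CycleAdj : ℕ → ℕ → ℕ → Set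
CycleAdj m a b = CycleNext m a b ⊎ CycleNext m b a

-- Neighbours of the cycle vertex labelled suc i, by their labels minus one.
record CycleNeighbours (m i : ℕ) : Set where
  field
    left right : ℕ
    left<m     : left < m
    right<m    : right < m
    left≢right : left ≢ right
    adj-left   : CycleAdj m (suc i) (suc left)
    adj-right  : CycleAdj m (suc i) (suc right)
    only       : ∀ {y} → y < m → CycleAdj m (suc i) (suc y) → y ≡ left ⊎ y ≡ right

cycle-neighbours : {m i : ℕ} → 3 ≤ m → i < m → CycleNeighbours m i
cycle-neighbours {suc (suc (suc m′))} {zero} (s≤s (s≤s (s≤s _))) _ = record
  { left = suc (suc m′) ; right = 1 ; left<m = ≤-refl ; right<m = s≤s (s≤s z≤n)
  ; left≢right = λ () ; adj-left = inj₂ (inj₂ (refl , refl)) ; adj-right = inj₁ (inj₁ refl)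
  ; only = λ where
      _ (inj₁ (inj₁ refl))       → inj₂ refl
      _ (inj₁ (inj₂ (() , _)))
      _ (inj₂ (inj₁ ()))
      _ (inj₂ (inj₂ (refl , _))) → inj₁ refl }
cycle-neighbours {suc (suc (suc m′))} {suc i} (s≤s (s≤s (s≤s _))) i<m
  with suc (suc i) ≟ℕ suc (suc (suc m′))
... | yes refl = record
  { left = suc m′ ; right = 0 ; left<m = s≤s (n≤1+n _) ; right<m = s≤s z≤n
  ; left≢right = λ () ; adj-left = inj₂ (inj₁ refl) ; adj-right = inj₁ (inj₂ (refl , refl))
  ; only = λ where
      y<m (inj₁ (inj₁ refl))     → contradiction y<m (<-irrefl refl)
      _   (inj₁ (inj₂ (_ , refl))) → inj₂ refl
      _   (inj₂ (inj₁ refl))       → inj₁ refl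
      _   (inj₂ (inj₂ (_ , ()))) }
... | no  i≢m = record
  { left = i ; right = suc (suc i) ; left<m = ≤-trans (n≤1+n _) i<m ; right<m = ≤∧≢⇒< i<m i≢m
  ; left≢right = <⇒≢ (s≤s (n≤1+n i)) ; adj-left = inj₂ (inj₁ refl) ; adj-right = inj₁ (inj₁ refl)
  ; only = λ where
      _ (inj₁ (inj₁ refl))     → inj₂ refl
      _ (inj₁ (inj₂ (e , _)))  → contradiction e i≢m
      _ (inj₂ (inj₁ refl))     → inj₁ refl
      _ (inj₂ (inj₂ (_ , ()))) }

WheelAdj-sym : {m : ℕ} → Symmetric (WheelAdj (suc m))
WheelAdj-sym (inj₁ (u≡0 , v≢0))                = inj₂ (inj₁ (v≢0 , u≡0))
WheelAdj-sym (inj₂ (inj₁ (u≢0 , v≡0)))         = inj₁ (v≡0 , u≢0)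
WheelAdj-sym (inj₂ (inj₂ (u≢0 , v≢0 , u~v)))   = inj₂ (inj₂ (v≢0 , u≢0 , ⊎-swap u~v))

wheel-spoke : {m : ℕ} (j : Fin m) → WheelAdj (suc m) zero (suc j)
wheel-spoke j = inj₁ (refl , λ ())

wheel-rim : {m : ℕ} → 3 ≤ m → (j : Fin m) → RimNeighbours (WheelAdj (suc m)) j
wheel-rim {m} 3≤m j = record
  { left = fromℕ< left<m ; right = fromℕ< right<m
  ; left≢right = left≢right ∘ fromℕ<-injective _ _ left<m right<m
  ; adj-left = rim-edge (subst (CycleAdj m _ ∘ suc) (sym (toℕ-fromℕ< left<m)) adj-left)
  ; adj-right = rim-edge (subst (CycleAdj m _ ∘ suc) (sym (toℕ-fromℕ< right<m)) adj-right)
  ; only = λ where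
      (inj₁ (() , _))
      (inj₂ (inj₁ (_ , ())))
      (inj₂ (inj₂ (_ , _ , adj))) →
        [ inj₁ ∘ label≡ left<m , inj₂ ∘ label≡ right<m ]′ (only (toℕ<n _) adj) }
  where
  open CycleNeighbours (cycle-neighbours 3≤m (toℕ<n j))
  rim-edge : ∀ {x} → CycleAdj m (suc (toℕ j)) (suc (toℕ x)) → WheelAdj (suc m) (suc j) (suc x)
  rim-edge adj = inj₂ (inj₂ ((λ ()) , (λ ()) , adj))
  label≡ : ∀ {x : Fin m} {y} (y<m : y < m) → toℕ x ≡ y → x ≡ fromℕ< y<m
  label≡ y<m x≡y = toℕ-injective (trans x≡y (sym (toℕ-fromℕ< y<m)))

%2≡0⇒even : ∀ n → n % 2 ≡ 0 → ∃ λ N → n ≡ N + N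
%2≡0⇒even zero          _  = 0 , refl
%2≡0⇒even (suc (suc n)) n% = let N , n≡ = %2≡0⇒even n n% in
  suc N , cong suc (trans (cong suc n≡) (sym (+-suc N N)))

%2≡1⇒odd : ∀ n → n % 2 ≡ 1 → ∃ λ N → n ≡ suc (N + N)
%2≡1⇒odd (suc zero)    _  = 0 , refl
%2≡1⇒odd (suc (suc n)) n% = let N , n≡ = %2≡1⇒odd n n% in
  suc N , cong suc (trans (cong suc n≡) (cong suc (sym (+-suc N N))))

theorem3p5 : (n : ℕ) → 4 ≤ n → (k : ℕ) → IsLambda (WheelAdj n) k →
    ((n % 2 ≡ 1 → Player1Wins (WheelAdj n) k) × (n % 2 ≡ 0 → Player2Wins (WheelAdj n) k))
theorem3p5 (suc m) (s≤s 3≤m) k ((c , c-distinguishing) , _) = odd-case , even-case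
  where
  open Cone WheelAdj-sym wheel-spoke (wheel-rim 3≤m)
  n≤k : suc m ≤ k
  n≤k = injective⇒≤ (edgeDistinguishing⇒injective c-distinguishing)
  odd-case : suc m % 2 ≡ 1 → Player1Wins (WheelAdj (suc m)) k
  odd-case n-odd with %2≡1⇒odd (suc m) n-odd
  ... | N , n≡ = hub-first-wins n≤k N (ℕ-suc-injective n≡)
  even-case : suc m % 2 ≡ 0 → Player2Wins (WheelAdj (suc m)) k
  even-case n-even with %2≡0⇒even (suc m) n-even
  ... | suc N , n≡ = hub-second-wins n≤k N (trans (ℕ-suc-injective n≡) (+-suc N N))
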